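{- Let $M$ be a max shuffle on $S_n$ and $w\in S_n$ with $w\notin U_n$. Then $M(w)\notin U_n$.
   Context: $[n]=\{1,\dots,n\}$, $[a,b]=\{a,\dots,b\}$; $S_n$ is the group of bijections $[n]\to[n]$. A homing shuffle is a map $F:S_n\to S_n$ such that for every $w\in S_n$, setting $k:=w(1)$: (a) $F(w)(k)=k$, and (b) $F(w)(i)=w(i)$ for all $i>k$. A max shuffle is a homing shuffle $M$ such that for every $w\in S_n$ with $w(1)\neq1$, $M(w)(1)=\max(w([2,k]))$ where $k=w(1)$. For $w\in S_n$, $i_w$ is the smallest $k\in[n]$ with $w([k])=[k]$, and $U_n:=\{w\in S_n : \text{there is } i>i_w \text{ with } w(i)\neq i\}$. -}

module Defs where

open import Data.Nat using (ℕ; zero; suc; _≤_; _<_)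
open import Data.Fin using (Fin; toℕ) renaming (zero to fzero)
open import Data.Fin.Permutation using (Permutation′; _⟨$⟩ʳ_)
open import Data.Product using (Σ; _×_; ∃; ∃-syntax)
open import Relation.Binary.PropositionalEquality using (_≡_; _≢_)
open import Relation.Nullary using (¬_)

-- Convention: S_n with n = suc m.  The element j : Fin (suc m) stands for the
-- integer toℕ j + 1 ∈ [n].  So position 1 is fzero, and "i ≤ k" in [n]
-- corresponds to toℕ i ≤ toℕ k.

Perm : ℕ → Set
Perm n = Permutation′ n

app : ∀ {n} → Perm n → Fin n → Fin n
app w i = w ⟨$⟩ʳ i

IsHoming : ∀ {m} → (Perm (suc m) → Perm (suc m)) → Set
IsHoming {m} F =
  ∀ (w : Perm (suc m)) →
    let k = app w fzero in
    (app (F w) k ≡ k) ×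
    (∀ (i : Fin (suc m)) → toℕ k < toℕ i → app (F w) i ≡ app w i)

-- x is the maximum of the set w([2,k]) = { w(i) : 2 ≤ i ≤ k }
-- (positions i with 1 ≤ toℕ i ≤ toℕ k)
IsMaxOfSegment : ∀ {m} → Perm (suc m) → Fin (suc m) → Fin (suc m) → Set
IsMaxOfSegment {m} w k x =
  (∃[ i ] (1 ≤ toℕ i × toℕ i ≤ toℕ k × app w i ≡ x)) ×
  (∀ (i : Fin (suc m)) → 1 ≤ toℕ i → toℕ i ≤ toℕ k → toℕ (app w i) ≤ toℕ x)

IsMaxShuffle : ∀ {m} → (Perm (suc m) → Perm (suc m)) → Set
IsMaxShuffle {m} M =
  IsHoming M ×
  (∀ (w : Perm (suc m)) → app w fzero ≢ fzero →
     IsMaxOfSegment w (app w fzero) (app (M w) fzero))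

-- w([k]) = [k]   (k a natural number; [k] = positions i with toℕ i < k)
PrefixStable : ∀ {n} → Perm n → ℕ → Set
PrefixStable {n} w k =
  (∀ (i : Fin n) → toℕ i < k → toℕ (app w i) < k) ×
  (∀ (j : Fin n) → toℕ j < k → ∃[ i ] (toℕ i < k × app w i ≡ j))

IsIw : ∀ {n} → Perm n → ℕ → Set
IsIw {n} w k =
  1 ≤ k × k ≤ n × PrefixStable w k ×
  (∀ (k' : ℕ) → 1 ≤ k' → k' < k → ¬ PrefixStable w k')

-- w ∈ U_n : there is i > i_w with w(i) ≠ i.
-- (1-based position toℕ i + 1 > i_w  ⇔  i_w ≤ toℕ i)
InU : ∀ {n} → Perm n → Set
InU {n} w =
  ∃[ k ] (IsIw w k × ∃[ i ] (k ≤ toℕ i × app w i ≢ i))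

-- Let k = w(1), j = i_{M(w)}, and suppose M(w) moves some position i > j. The values
-- w(2), …, w(k) are distinct and at most M(w)(1) ≤ j, so k ≤ j + 1 ≤ i; as M(w) fixes k,
-- in fact i > k, where M(w) agrees with w. For t = max(j, k), w maps [t] into [t]
-- (w(1) = k, w([2,k]) lies below M(w)(1), and w = M(w) on [k+1, j]), hence onto it.
-- So i_w ≤ t < i and w(i) = M(w)(i) ≠ i put w in U_n.

module Submission where

open import Defs
open import Data.Nat using (ℕ; zero; suc; _≤_; _<_; _⊔_; z≤n; s≤s; s≤s⁻¹)
open import Data.Nat.Properties
  using (≤-refl; ≤-trans; <-≤-trans; ≤-<-trans; <⇒≤; <⇒≱; <-irrefl; 1+n≰n;
         n≤0⇒n≡0; m≤n⇒m<n∨m≡n; m≤n⇒m≤1+n; ≮⇒≥; ≰⇒>; <-cmp; ⊔-lub; m≤m⊔n; m≤n⊔m; _≤?_; _<?_)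
open import Data.Fin using (Fin; toℕ; fromℕ<; inject≤) renaming (zero to fzero; suc to fsuc)
open import Data.Fin.Properties
  using (toℕ-injective; toℕ-fromℕ<; toℕ-inject≤; inject≤-injective; suc-injective; injective⇒≤; toℕ<n; all?; _≟_)
open import Data.Fin.Permutation using (_⟨$⟩ˡ_; inverseˡ; inverseʳ)
open import Data.Product using (_×_; ∃-syntax; _,_; proj₁; proj₂)
open import Data.Sum using (_⊎_; inj₁; inj₂)
open import Function using (_∘_)
open import Function.Definitions using (Injective)
open import Relation.Binary.Definitions using (tri<; tri≈; tri>)
open import Relation.Binary.PropositionalEquality using (_≡_; refl; sym; trans; cong; subst)
open import Relation.Nullary using (¬_; yes; no; contradiction)
open import Relation.Nullary.Decidable using (_×-dec_; _→-dec_)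
open import Relation.Unary using (Decidable)

module _ {p} {P : ℕ → Set p} (P? : Decidable P) where

  Least : ℕ → Set p
  Least k = P k × (∀ {k′} → k′ < k → ¬ P k′)

  least-or-none : ∀ t → (∃[ k ] (k ≤ t × Least k)) ⊎ (∀ {k} → k ≤ t → ¬ P k)
  least-or-none zero with P? zero
  ... | yes p0 = inj₁ (zero , z≤n , p0 , λ ())
  ... | no ¬p0 = inj₂ λ k≤0 → subst (¬_ ∘ P) (sym (n≤0⇒n≡0 k≤0)) ¬p0
  least-or-none (suc t) with least-or-none t
  ... | inj₁ (k , k≤t , least) = inj₁ (k , m≤n⇒m≤1+n k≤t , least)
  ... | inj₂ none with P? (suc t)
  ...   | yes pt = inj₁ (suc t , ≤-refl , pt , none ∘ s≤s⁻¹)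
  ...   | no ¬pt = inj₂ none′
    where
    none′ : ∀ {k} → k ≤ suc t → ¬ P k
    none′ k≤1+t with m≤n⇒m<n∨m≡n k≤1+t
    ... | inj₁ k<1+t = none (s≤s⁻¹ k<1+t)
    ... | inj₂ refl  = ¬pt

  least-≤ : ∀ {t} → P t → ∃[ k ] (k ≤ t × Least k)
  least-≤ {t} pt with least-or-none t
  ... | inj₁ found = found
  ... | inj₂ none  = contradiction pt (none ≤-refl)

app-injective : ∀ {n} (w : Perm n) → Injective _≡_ _≡_ (app w)
app-injective w wa≡wb =
  trans (sym (inverseˡ w)) (trans (cong (w ⟨$⟩ˡ_) wa≡wb) (inverseˡ w))

injective-below⇒≤ : ∀ {s n t} (f : Fin s → Fin n) → Injective _≡_ _≡_ f →
  (∀ q → toℕ (f q) < t) → s ≤ t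
injective-below⇒≤ f f-inj f<t = injective⇒≤ lowered-injective
  where
  lowered-injective : Injective _≡_ _≡_ (λ q → fromℕ< (f<t q))
  lowered-injective {a} {b} e = f-inj (toℕ-injective
    (trans (sym (toℕ-fromℕ< (f<t a))) (trans (cong toℕ e) (toℕ-fromℕ< (f<t b)))))

MapsBelow : ∀ {n} → Perm n → ℕ → Set
MapsBelow w t = ∀ i → toℕ i < t → toℕ (app w i) < t

mapsBelow? : ∀ {n} (w : Perm n) → Decidable (MapsBelow w)
mapsBelow? w t = all? (λ i → (toℕ i <? t) →-dec (toℕ (app w i) <? t))

-- An injective self-map of the finite set [t] is onto.
mapsBelow⇒prefixStable : ∀ {n} (w : Perm n) {t} → MapsBelow w t → PrefixStable w t
mapsBelow⇒prefixStable {n} w {t} below = below , hit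
  where
  hit : ∀ y → toℕ y < t → ∃[ i ] (toℕ i < t × app w i ≡ y)
  hit y y<t with toℕ (w ⟨$⟩ˡ y) <? t
  ... | yes p<t = w ⟨$⟩ˡ y , p<t , inverseʳ w
  ... | no p≮t = contradiction (injective-below⇒≤ (app w ∘ g) (g-injective ∘ app-injective w) wg<t) 1+n≰n
    where
    p = w ⟨$⟩ˡ y
    t≤p : t ≤ toℕ p
    t≤p = ≮⇒≥ p≮t
    t≤n : t ≤ n
    t≤n = ≤-trans t≤p (<⇒≤ (toℕ<n p))
    -- p is outside [t], so [t] ∪ {p} has t + 1 elements, all sent below t.
    g : Fin (suc t) → Fin n
    g fzero    = p
    g (fsuc q) = inject≤ q t≤n
    inject≤≢p : ∀ q → inject≤ q t≤n ≡ p → ¬ (t ≤ toℕ p)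
    inject≤≢p q e = <⇒≱ (subst (_< t) (trans (sym (toℕ-inject≤ q t≤n)) (cong toℕ e)) (toℕ<n q))
    g-injective : Injective _≡_ _≡_ g
    g-injective {fzero}  {fzero}  _ = refl
    g-injective {fzero}  {fsuc r} e = contradiction t≤p (inject≤≢p r (sym e))
    g-injective {fsuc q} {fzero}  e = contradiction t≤p (inject≤≢p q e)
    g-injective {fsuc q} {fsuc r} e = cong fsuc (inject≤-injective t≤n t≤n q r e)
    wg<t : ∀ q → toℕ (app w (g q)) < t
    wg<t fzero    = subst (λ z → toℕ z < t) (sym (inverseʳ w)) y<t
    wg<t (fsuc q) = below (inject≤ q t≤n) (subst (_< t) (sym (toℕ-inject≤ q t≤n)) (toℕ<n q))

∃iw≤ : ∀ {n} (w : Perm n) {t} → 1 ≤ t → t ≤ n → MapsBelow w t → ∃[ k ] (IsIw w k × k ≤ t)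
∃iw≤ w 1≤t t≤n below with least-≤ (λ k → (1 ≤? k) ×-dec mapsBelow? w k) (1≤t , below)
... | k , k≤t , (1≤k , belowₖ) , smaller =
  k , (1≤k , ≤-trans k≤t t≤n , mapsBelow⇒prefixStable w belowₖ ,
       λ k′ 1≤k′ k′<k stable → smaller k′<k (1≤k′ , proj₁ stable)) , k≤t

¬InU⇒fixed-beyond : ∀ {n} (w : Perm n) {t} → ¬ InU w → 1 ≤ t → t ≤ n → MapsBelow w t →
  ∀ i → t ≤ toℕ i → app w i ≡ i
¬InU⇒fixed-beyond w w∉U 1≤t t≤n below i t≤i with app w i ≟ i
... | yes fixed = fixed
... | no moved with ∃iw≤ w 1≤t t≤n below
...   | k , isIw , k≤t = contradiction (k , isIw , i , ≤-trans k≤t t≤i , moved) w∉U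

module _ {m} {M : Perm (suc m) → Perm (suc m)} (isMax : IsMaxShuffle M) (w : Perm (suc m)) where

  private
    k = app w fzero
    x = app (M w) fzero

  segment≤max : ∀ p → 1 ≤ toℕ p → toℕ p ≤ toℕ k → toℕ (app w p) ≤ toℕ x
  segment≤max p 1≤p p≤k = proj₂ (proj₂ isMax w k≢0) p 1≤p p≤k
    where
    k≢0 : ¬ (k ≡ fzero)
    k≢0 k≡0 = <⇒≱ 1≤p (subst (λ z → toℕ p ≤ toℕ z) k≡0 p≤k)

  mapsBelow⇒toℕ-w1≤ : ∀ {j} → 1 ≤ j → MapsBelow (M w) j → toℕ k ≤ j
  mapsBelow⇒toℕ-w1≤ {j} 1≤j Mw-below =
    injective-below⇒≤ (app w ∘ segment) (segment-injective ∘ app-injective w) segment-below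
    where
    k≤m : toℕ k ≤ m
    k≤m = s≤s⁻¹ (toℕ<n k)
    segment : Fin (toℕ k) → Fin (suc m)
    segment q = fsuc (inject≤ q k≤m)
    segment-injective : Injective _≡_ _≡_ segment
    segment-injective {q} {r} e = inject≤-injective k≤m k≤m q r (suc-injective e)
    segment-below : ∀ q → toℕ (app w (segment q)) < j
    segment-below q = ≤-<-trans
      (segment≤max (segment q) (s≤s z≤n) (subst (λ z → suc z ≤ toℕ k) (sym (toℕ-inject≤ q k≤m)) (toℕ<n q)))
      (Mw-below fzero 1≤j)

  mapsBelow-⊔ : ∀ {j} → 1 ≤ j → MapsBelow (M w) j → MapsBelow w (j ⊔ suc (toℕ k))
  mapsBelow-⊔ {j} 1≤j Mw-below fzero    _   = m≤n⊔m j (suc (toℕ k))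
  mapsBelow-⊔ {j} 1≤j Mw-below (fsuc p) p<t with toℕ (fsuc p) ≤? toℕ k
  ... | yes p≤k = ≤-<-trans (segment≤max (fsuc p) (s≤s z≤n) p≤k)
                    (<-≤-trans (Mw-below fzero 1≤j) (m≤m⊔n j (suc (toℕ k))))
  ... | no p≰k = subst (_< j ⊔ suc (toℕ k)) (cong toℕ (proj₂ (proj₁ isMax w) (fsuc p) k<p))
                   (<-≤-trans (Mw-below (fsuc p) p<j) (m≤m⊔n j (suc (toℕ k))))
    where
    k<p = ≰⇒> p≰k
    p<j : toℕ (fsuc p) < j
    p<j = ≰⇒> λ j≤p → <⇒≱ p<t (⊔-lub j≤p k<p)

  fixed-beyond-⊔ : ¬ InU w → ∀ {j} → 1 ≤ j → j ≤ suc m → MapsBelow (M w) j →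
    ∀ i → j ⊔ suc (toℕ k) ≤ toℕ i → app w i ≡ i
  fixed-beyond-⊔ w∉U {j} 1≤j j≤n Mw-below =
    ¬InU⇒fixed-beyond w w∉U (≤-trans 1≤j (m≤m⊔n j (suc (toℕ k)))) (⊔-lub j≤n (toℕ<n k))
      (mapsBelow-⊔ 1≤j Mw-below)

lemma5 : (m : ℕ) (M : Perm (suc m) → Perm (suc m)) → IsMaxShuffle M →
    (w : Perm (suc m)) → ¬ InU w → ¬ InU (M w)
lemma5 m M isMax w w∉U (j , (1≤j , j≤n , (Mw-below , _) , _) , i , j≤i , Mwi≢i)
  with proj₁ isMax w | <-cmp (toℕ i) (toℕ (app w fzero))
... | _ , _ | tri< i<k _ _ =
  <-irrefl refl (≤-<-trans (≤-trans (mapsBelow⇒toℕ-w1≤ {M = M} isMax w 1≤j Mw-below) j≤i) i<k)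
... | fixes-k , _ | tri≈ _ i≡k _ =
  Mwi≢i (subst (λ z → app (M w) z ≡ z) (sym (toℕ-injective i≡k)) fixes-k)
... | _ , agrees | tri> _ _ k<i =
  Mwi≢i (trans (agrees i k<i) (fixed-beyond-⊔ {M = M} isMax w w∉U 1≤j j≤n Mw-below i (⊔-lub j≤i k<i)))
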